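{- For all non-negative integers $n$, \[T_n^2=T_n+\sum_{k=2}^{n-2}\sum_{l=2}^k\{4(T_l+T_{l-1})-2\delta_{l,2}\}T_{k-l+2}^2T_{n-k}.\]
   Context: Tribonacci numbers: $T_n=T_{n-1}+T_{n-2}+T_{n-3}+\delta_{n,2}$ for all integers $n$, with $T_n=0$ for $n<2$; $\delta_{i,j}$ is $1$ if $i=j$ and $0$ otherwise. Empty sums are zero. -}

module Defs where

open import Data.Nat using (ℕ; zero; suc; _+_; _*_; _∸_)
open import Data.List using (List; map)
open import Data.Nat.ListAction using (sum)
open import Data.List using (upTo)

T : ℕ → ℕ
T 0 = 0
T 1 = 0
T 2 = 1
T (suc (suc (suc n))) = T (suc (suc n)) + T (suc n) + T n

δ : ℕ → ℕ → ℕ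
δ zero zero = 1
δ zero (suc _) = 0
δ (suc _) zero = 0
δ (suc i) (suc j) = δ i j

-- Σ_{i=a}^{b} f i  (empty, i.e. 0, when b < a)
Σ[_⋯_] : ℕ → ℕ → (ℕ → ℕ) → ℕ
Σ[ a ⋯ b ] f = sum (map (λ i → f (a + i)) (upTo (suc b ∸ a)))

{-# OPTIONS --safe #-}
-- Read integer sequences as formal power series and let D be multiplication by
-- 1 − x − x² − x³, so that D t = x² for the Tribonacci series t. The coefficients
-- c_l = 4(T_l + T_{l−1}) − 2δ_{l,2} satisfy D c = x² Q with Q = 2 + 6x + 2x² + 2x³, while the
-- squares s = t² satisfy D (D s − x²) = x² Q s; as D is injective, c s = D s − x².
-- The inner sum of the theorem is a = c s / x², and D (a t) = x² a = c s = D (s − t),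
-- so s = t + a t, which read coefficientwise is the identity.
module Submission where

open import Data.Nat using (ℕ; zero; suc; _∸_)
open import Data.Product using (_×_; _,_; proj₁)
open import Function using (_∘_)
open import Relation.Binary.PropositionalEquality
  using (_≡_; _≗_; refl; sym; trans; cong; cong₂; module ≡-Reasoning)

module PowerSeries where
  open import Data.Integer using (ℤ; 0ℤ; 1ℤ; _+_; _*_; -_; _-_)
  import Data.Integer.Properties as ℤ
  open import Data.Integer.Tactic.RingSolver using (solve-∀)
  open import Algebra.Properties.CommutativeSemigroup ℤ.+-commutativeSemigroup
    using (interchange)
  open import Algebra.Properties.AbelianGroup ℤ.+-0-abelianGroup using (∙-cancelʳ)
  open ≡-Reasoning

  Series : Set
  Series = ℕ → ℤ

  infixl 6 _⊕_ _⊖_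
  infixl 7 _⋆_

  _⊕_ _⊖_ : Series → Series → Series
  (f ⊕ g) n = f n + g n
  (f ⊖ g) n = f n - g n

  𝟘 𝟙 : Series
  𝟘 _ = 0ℤ
  𝟙 zero = 1ℤ
  𝟙 (suc _) = 0ℤ

  shift : Series → Series
  shift f zero = 0ℤ
  shift f (suc n) = f n

  shift^ : ℕ → Series → Series
  shift^ zero f = f
  shift^ (suc k) f = shift (shift^ k f)

  _⋆_ : Series → Series → Series
  (f ⋆ g) zero = f 0 * g 0
  (f ⋆ g) (suc n) = f 0 * g (suc n) + ((f ∘ suc) ⋆ g) n

  shift-cong : ∀ {f g} → f ≗ g → shift f ≗ shift g
  shift-cong f≗g zero = refl
  shift-cong f≗g (suc n) = f≗g n

  shift^-cong : ∀ k {f g} → f ≗ g → shift^ k f ≗ shift^ k g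
  shift^-cong zero f≗g = f≗g
  shift^-cong (suc k) f≗g = shift-cong (shift^-cong k f≗g)

  ⋆-congˡ : ∀ {f f′} g → f ≗ f′ → f ⋆ g ≗ f′ ⋆ g
  ⋆-congˡ g f≗f′ zero = cong (_* g 0) (f≗f′ 0)
  ⋆-congˡ g f≗f′ (suc n) =
    cong₂ _+_ (cong (_* g (suc n)) (f≗f′ 0)) (⋆-congˡ g (f≗f′ ∘ suc) n)

  ⋆-congʳ : ∀ f {g g′} → g ≗ g′ → f ⋆ g ≗ f ⋆ g′
  ⋆-congʳ f g≗g′ zero = cong (f 0 *_) (g≗g′ 0)
  ⋆-congʳ f g≗g′ (suc n) =
    cong₂ _+_ (cong (f 0 *_) (g≗g′ (suc n))) (⋆-congʳ (f ∘ suc) g≗g′ n)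

  ⋆-zeroˡ : ∀ g → 𝟘 ⋆ g ≗ 𝟘
  ⋆-zeroˡ g zero = ℤ.*-zeroˡ (g 0)
  ⋆-zeroˡ g (suc n) = cong₂ _+_ (ℤ.*-zeroˡ (g (suc n))) (⋆-zeroˡ g n)

  ⋆-identityʳ : ∀ f → f ⋆ 𝟙 ≗ f
  ⋆-identityʳ f zero = ℤ.*-identityʳ (f 0)
  ⋆-identityʳ f (suc n) = begin
    f 0 * 0ℤ + ((f ∘ suc) ⋆ 𝟙) n ≡⟨ cong₂ _+_ (ℤ.*-zeroʳ (f 0)) (⋆-identityʳ (f ∘ suc) n) ⟩
    0ℤ + f (suc n)                 ≡⟨ ℤ.+-identityˡ (f (suc n)) ⟩
    f (suc n)                      ∎

  ⋆-shiftˡ : ∀ f g → shift f ⋆ g ≗ shift (f ⋆ g)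
  ⋆-shiftˡ f g zero = ℤ.*-zeroˡ (g 0)
  ⋆-shiftˡ f g (suc n) =
    trans (cong (_+ (f ⋆ g) n) (ℤ.*-zeroˡ (g (suc n)))) (ℤ.+-identityˡ ((f ⋆ g) n))

  ⋆-shiftʳ : ∀ f g → f ⋆ shift g ≗ shift (f ⋆ g)
  ⋆-shiftʳ f g zero = ℤ.*-zeroʳ (f 0)
  ⋆-shiftʳ f g (suc zero) =
    trans (cong (f 0 * g 0 +_) (⋆-shiftʳ (f ∘ suc) g zero)) (ℤ.+-identityʳ (f 0 * g 0))
  ⋆-shiftʳ f g (suc (suc n)) = cong (f 0 * g (suc n) +_) (⋆-shiftʳ (f ∘ suc) g (suc n))

  ⋆-shift^ˡ : ∀ k f g → shift^ k f ⋆ g ≗ shift^ k (f ⋆ g)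
  ⋆-shift^ˡ zero f g = λ _ → refl
  ⋆-shift^ˡ (suc k) f g n =
    trans (⋆-shiftˡ (shift^ k f) g n) (shift-cong (⋆-shift^ˡ k f g) n)

  ⋆-shift^ʳ : ∀ k f g → f ⋆ shift^ k g ≗ shift^ k (f ⋆ g)
  ⋆-shift^ʳ zero f g = λ _ → refl
  ⋆-shift^ʳ (suc k) f g n =
    trans (⋆-shiftʳ f (shift^ k g) n) (shift-cong (⋆-shift^ʳ k f g) n)

  ⋆-distribˡ-⊕ : ∀ f g h → f ⋆ (g ⊕ h) ≗ f ⋆ g ⊕ f ⋆ h
  ⋆-distribˡ-⊕ f g h zero = ℤ.*-distribˡ-+ (f 0) (g 0) (h 0)
  ⋆-distribˡ-⊕ f g h (suc n) = begin
    f 0 * (g (suc n) + h (suc n)) + ((f ∘ suc) ⋆ (g ⊕ h)) n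
      ≡⟨ cong₂ _+_ (ℤ.*-distribˡ-+ (f 0) (g (suc n)) (h (suc n)))
                   (⋆-distribˡ-⊕ (f ∘ suc) g h n) ⟩
    (f 0 * g (suc n) + f 0 * h (suc n)) + (((f ∘ suc) ⋆ g) n + ((f ∘ suc) ⋆ h) n)
      ≡⟨ interchange (f 0 * g (suc n)) (f 0 * h (suc n)) (((f ∘ suc) ⋆ g) n) (((f ∘ suc) ⋆ h) n) ⟩
    (f ⋆ g) (suc n) + (f ⋆ h) (suc n)
      ∎

  ⋆-distribʳ-⊕ : ∀ f g h → (f ⊕ g) ⋆ h ≗ f ⋆ h ⊕ g ⋆ h
  ⋆-distribʳ-⊕ f g h zero = ℤ.*-distribʳ-+ (h 0) (f 0) (g 0)
  ⋆-distribʳ-⊕ f g h (suc n) = begin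
    (f 0 + g 0) * h (suc n) + ((f ∘ suc ⊕ g ∘ suc) ⋆ h) n
      ≡⟨ cong₂ _+_ (ℤ.*-distribʳ-+ (h (suc n)) (f 0) (g 0))
                   (⋆-distribʳ-⊕ (f ∘ suc) (g ∘ suc) h n) ⟩
    (f 0 * h (suc n) + g 0 * h (suc n)) + (((f ∘ suc) ⋆ h) n + ((g ∘ suc) ⋆ h) n)
      ≡⟨ interchange (f 0 * h (suc n)) (g 0 * h (suc n)) (((f ∘ suc) ⋆ h) n) (((g ∘ suc) ⋆ h) n) ⟩
    (f ⋆ h) (suc n) + (g ⋆ h) (suc n)
      ∎

  ⋆-distribˡ-⊖ : ∀ f g h → f ⋆ (g ⊖ h) ≗ f ⋆ g ⊖ f ⋆ h
  ⋆-distribˡ-⊖ f g h zero =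
    trans (ℤ.*-distribˡ-+ (f 0) (g 0) (- h 0)) (cong (f 0 * g 0 +_) (sym (ℤ.neg-distribʳ-* (f 0) (h 0))))
  ⋆-distribˡ-⊖ f g h (suc n) =
    trans (cong (f 0 * (g (suc n) - h (suc n)) +_) (⋆-distribˡ-⊖ (f ∘ suc) g h n))
          (regroup (f 0) (g (suc n)) (h (suc n)) (((f ∘ suc) ⋆ g) n) (((f ∘ suc) ⋆ h) n))
    where
    regroup : ∀ a x y u v → a * (x - y) + (u - v) ≡ (a * x + u) - (a * y + v)
    regroup = solve-∀

  ⋆-distribʳ-⊖ : ∀ f g h → (f ⊖ g) ⋆ h ≗ f ⋆ h ⊖ g ⋆ h
  ⋆-distribʳ-⊖ f g h zero =
    trans (ℤ.*-distribʳ-+ (h 0) (f 0) (- g 0)) (cong (f 0 * h 0 +_) (sym (ℤ.neg-distribˡ-* (g 0) (h 0))))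
  ⋆-distribʳ-⊖ f g h (suc n) =
    trans (cong ((f 0 - g 0) * h (suc n) +_) (⋆-distribʳ-⊖ (f ∘ suc) (g ∘ suc) h n))
          (regroup (h (suc n)) (f 0) (g 0) (((f ∘ suc) ⋆ h) n) (((g ∘ suc) ⋆ h) n))
    where
    regroup : ∀ a x y u v → (x - y) * a + (u - v) ≡ (x * a + u) - (y * a + v)
    regroup = solve-∀

  x+x²+x³ : Series → Series
  x+x²+x³ f = shift^ 1 f ⊕ shift^ 2 f ⊕ shift^ 3 f

  D : Series → Series
  D f = f ⊖ x+x²+x³ f

  x+x²+x³-⋆ˡ : ∀ f g → x+x²+x³ f ⋆ g ≗ x+x²+x³ (f ⋆ g)
  x+x²+x³-⋆ˡ f g n =
    trans (⋆-distribʳ-⊕ (shift^ 1 f ⊕ shift^ 2 f) (shift^ 3 f) g n)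
      (cong₂ _+_
        (trans (⋆-distribʳ-⊕ (shift^ 1 f) (shift^ 2 f) g n)
          (cong₂ _+_ (⋆-shift^ˡ 1 f g n) (⋆-shift^ˡ 2 f g n)))
        (⋆-shift^ˡ 3 f g n))

  x+x²+x³-⋆ʳ : ∀ f g → f ⋆ x+x²+x³ g ≗ x+x²+x³ (f ⋆ g)
  x+x²+x³-⋆ʳ f g n =
    trans (⋆-distribˡ-⊕ f (shift^ 1 g ⊕ shift^ 2 g) (shift^ 3 g) n)
      (cong₂ _+_
        (trans (⋆-distribˡ-⊕ f (shift^ 1 g) (shift^ 2 g) n)
          (cong₂ _+_ (⋆-shift^ʳ 1 f g n) (⋆-shift^ʳ 2 f g n)))
        (⋆-shift^ʳ 3 f g n))

  D-⋆ˡ : ∀ f g → D f ⋆ g ≗ D (f ⋆ g)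
  D-⋆ˡ f g n =
    trans (⋆-distribʳ-⊖ f (x+x²+x³ f) g n) (cong (_-_ ((f ⋆ g) n)) (x+x²+x³-⋆ˡ f g n))

  D-⋆ʳ : ∀ f g → f ⋆ D g ≗ D (f ⋆ g)
  D-⋆ʳ f g n =
    trans (⋆-distribˡ-⊖ f g (x+x²+x³ g) n) (cong (_-_ ((f ⋆ g) n)) (x+x²+x³-⋆ʳ f g n))

  shift^-⊖ : ∀ k f g → shift^ k (f ⊖ g) ≗ shift^ k f ⊖ shift^ k g
  shift^-⊖ zero f g n = refl
  shift^-⊖ (suc k) f g zero = refl
  shift^-⊖ (suc k) f g (suc n) = shift^-⊖ k f g n

  x+x²+x³-⊖ : ∀ f g → x+x²+x³ (f ⊖ g) ≗ x+x²+x³ f ⊖ x+x²+x³ g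
  x+x²+x³-⊖ f g n = begin
    x+x²+x³ (f ⊖ g) n
      ≡⟨ cong₂ _+_ (cong₂ _+_ (shift^-⊖ 1 f g n) (shift^-⊖ 2 f g n)) (shift^-⊖ 3 f g n) ⟩
    (a₁ - b₁) + (a₂ - b₂) + (a₃ - b₃)
      ≡⟨ regroup a₁ b₁ a₂ b₂ a₃ b₃ ⟩
    (a₁ + a₂ + a₃) - (b₁ + b₂ + b₃)
      ∎
    where
    a₁ = shift^ 1 f n ; a₂ = shift^ 2 f n ; a₃ = shift^ 3 f n
    b₁ = shift^ 1 g n ; b₂ = shift^ 2 g n ; b₃ = shift^ 3 g n
    regroup : ∀ a₁ b₁ a₂ b₂ a₃ b₃ →
      (a₁ - b₁) + (a₂ - b₂) + (a₃ - b₃) ≡ (a₁ + a₂ + a₃) - (b₁ + b₂ + b₃)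
    regroup = solve-∀

  D-⊖ : ∀ f g → D (f ⊖ g) ≗ D f ⊖ D g
  D-⊖ f g n =
    trans (cong (_-_ (f n - g n)) (x+x²+x³-⊖ f g n))
          (regroup (f n) (g n) (x+x²+x³ f n) (x+x²+x³ g n))
    where
    regroup : ∀ a b c d → (a - b) - (c - d) ≡ (a - c) - (b - d)
    regroup = solve-∀

  D-injective : ∀ {f g} → D f ≗ D g → f ≗ g
  D-injective {f} {g} Df≗Dg n = proj₁ (agree n)
    where
    agreeAt : ∀ n → shift^ 1 f n ≡ shift^ 1 g n → shift^ 2 f n ≡ shift^ 2 g n →
              shift^ 3 f n ≡ shift^ 3 g n → f n ≡ g n
    agreeAt n e₁ e₂ e₃ = ∙-cancelʳ (- x+x²+x³ g n) (f n) (g n)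
      (trans (cong (_-_ (f n)) (sym (cong₂ _+_ (cong₂ _+_ e₁ e₂) e₃))) (Df≗Dg n))

    agree : ∀ n → f n ≡ g n × f (suc n) ≡ g (suc n) × f (suc (suc n)) ≡ g (suc (suc n))
    agree zero = e₀ , e₁ , agreeAt 2 e₁ e₀ refl
      where
      e₀ = agreeAt 0 refl refl refl
      e₁ = agreeAt 1 e₀ refl refl
    agree (suc n) with agree n
    ... | e₀ , e₁ , e₂ = e₁ , e₂ , agreeAt (suc (suc (suc n))) e₂ e₁ e₀

  ∑ : ℕ → (ℕ → ℤ) → ℤ
  ∑ zero h = 0ℤ
  ∑ (suc m) h = h 0 + ∑ m (h ∘ suc)

  ∑-cong : ∀ m {h h′} → h ≗ h′ → ∑ m h ≡ ∑ m h′
  ∑-cong zero h≗h′ = refl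
  ∑-cong (suc m) h≗h′ = cong₂ _+_ (h≗h′ 0) (∑-cong m (h≗h′ ∘ suc))

  ∑-*-distribʳ : ∀ m h w → ∑ m h * w ≡ ∑ m (λ i → h i * w)
  ∑-*-distribʳ zero h w = ℤ.*-zeroˡ w
  ∑-*-distribʳ (suc m) h w =
    trans (ℤ.*-distribʳ-+ w (h 0) (∑ m (h ∘ suc))) (cong (h 0 * w +_) (∑-*-distribʳ m (h ∘ suc) w))

  ∑-dropLast : ∀ m h → h m ≡ 0ℤ → ∑ (suc m) h ≡ ∑ m h
  ∑-dropLast zero h h₀≡0 = trans (ℤ.+-identityʳ (h 0)) h₀≡0
  ∑-dropLast (suc m) h hₘ≡0 = cong (h 0 +_) (∑-dropLast m (h ∘ suc) hₘ≡0)

  ⋆-as-∑ : ∀ f g n → (f ⋆ g) n ≡ ∑ (suc n) (λ i → f i * g (n ∸ i))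
  ⋆-as-∑ f g zero = sym (ℤ.+-identityʳ (f 0 * g 0))
  ⋆-as-∑ f g (suc n) = cong (f 0 * g (suc n) +_) (⋆-as-∑ (f ∘ suc) g n)

  ⋆-as-∑-from-2 : ∀ f g → f 0 ≡ 0ℤ → f 1 ≡ 0ℤ →
    ∀ m → (f ⋆ g) (suc (suc m)) ≡ ∑ (suc m) (λ i → f (suc (suc i)) * g (m ∸ i))
  ⋆-as-∑-from-2 f g f₀≡0 f₁≡0 m = begin
    f 0 * g (suc (suc m)) + (f 1 * g (suc m) + ((f ∘ suc ∘ suc) ⋆ g) m)
      ≡⟨ cong₂ (λ x y → x * g (suc (suc m)) + (y * g (suc m) + ((f ∘ suc ∘ suc) ⋆ g) m)) f₀≡0 f₁≡0 ⟩
    0ℤ * g (suc (suc m)) + (0ℤ * g (suc m) + ((f ∘ suc ∘ suc) ⋆ g) m)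
      ≡⟨ vanish (g (suc (suc m))) (g (suc m)) (((f ∘ suc ∘ suc) ⋆ g) m) ⟩
    ((f ∘ suc ∘ suc) ⋆ g) m
      ≡⟨ ⋆-as-∑ (f ∘ suc ∘ suc) g m ⟩
    ∑ (suc m) (λ i → f (suc (suc i)) * g (m ∸ i))
      ∎
    where
    vanish : ∀ x y z → 0ℤ * x + (0ℤ * y + z) ≡ z
    vanish = solve-∀

module TribonacciSeries where
  open import Data.Integer using (ℤ; +_; 0ℤ; _+_; _*_; _-_)
  import Data.Integer.Properties as ℤ
  open import Data.Integer.Tactic.RingSolver using (solve-∀)
  open PowerSeries
  open ≡-Reasoning

  t : Series
  t 0 = 0ℤ
  t 1 = 0ℤ
  t 2 = + 1
  t (suc (suc (suc n))) = t (suc (suc n)) + t (suc n) + t n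

  s : Series
  s n = t n * t n

  δ₂ : Series
  δ₂ = shift^ 2 𝟙

  coeff : Series
  coeff l = + 4 * (t l + shift t l) - + 2 * δ₂ l

  Q : Series
  Q 0 = + 2
  Q 1 = + 6
  Q 2 = + 2
  Q 3 = + 2
  Q _ = 0ℤ

  D-t : D t ≗ δ₂
  D-t 0 = refl
  D-t 1 = refl
  D-t 2 = refl
  D-t (suc (suc (suc n))) = ℤ.+-inverseʳ (t (suc (suc n)) + t (suc n) + t n)

  D-coeff : D coeff ≗ shift^ 2 Q
  D-coeff 0 = refl
  D-coeff 1 = refl
  D-coeff 2 = refl
  D-coeff 3 = refl
  D-coeff 4 = refl
  D-coeff 5 = refl
  D-coeff (suc (suc (suc (suc (suc (suc m)))))) = vanish (t m) (t (suc m)) (t (suc (suc m)))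
    where
    vanish : ∀ t₀ t₁ t₂ →
      let t₃ = t₂ + t₁ + t₀ ; t₄ = t₃ + t₂ + t₁ ; t₅ = t₄ + t₃ + t₂ ; t₆ = t₅ + t₄ + t₃
          c : ℤ → ℤ → ℤ
          c x y = + 4 * (x + y) - 0ℤ
      in c t₆ t₅ - (c t₅ t₄ + c t₄ t₃ + c t₃ t₂) ≡ 0ℤ
    vanish = solve-∀

  -- The squares satisfy the order-6 recurrence with characteristic polynomial
  -- (1 − x − x² − x³)² − x² Q = 1 − 2x − 3x² − 6x³ + x⁴ + x⁶.
  D-D-squares : D (D s ⊖ δ₂) ≗ shift^ 2 (Q ⋆ s)
  D-D-squares 0 = refl
  D-D-squares 1 = refl
  D-D-squares 2 = refl
  D-D-squares 3 = refl
  D-D-squares 4 = refl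
  D-D-squares 5 = refl
  D-D-squares (suc (suc (suc (suc (suc (suc m)))))) =
    trans (step (t m) (t (suc m)) (t (suc (suc m))))
          (cong (λ z → + 2 * s m₄ + (+ 6 * s m₃ + (+ 2 * s m₂ + (+ 2 * s m₁ + z)))) (sym (⋆-zeroˡ s m)))
    where
    m₁ = suc m ; m₂ = suc m₁ ; m₃ = suc m₂ ; m₄ = suc m₃
    step : ∀ t₀ t₁ t₂ →
      let t₃ = t₂ + t₁ + t₀ ; t₄ = t₃ + t₂ + t₁ ; t₅ = t₄ + t₃ + t₂ ; t₆ = t₅ + t₄ + t₃
          d : ℤ → ℤ → ℤ → ℤ → ℤ
          d x₀ x₁ x₂ x₃ = x₃ * x₃ - (x₂ * x₂ + x₁ * x₁ + x₀ * x₀) - 0ℤ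
      in d t₃ t₄ t₅ t₆ - (d t₂ t₃ t₄ t₅ + d t₁ t₂ t₃ t₄ + d t₀ t₁ t₂ t₃)
         ≡ + 2 * (t₄ * t₄) + (+ 6 * (t₃ * t₃) + (+ 2 * (t₂ * t₂) + (+ 2 * (t₁ * t₁) + 0ℤ)))
    step = solve-∀

  coeff⋆s : coeff ⋆ s ≗ D s ⊖ δ₂
  coeff⋆s = D-injective λ n → begin
    D (coeff ⋆ s) n       ≡⟨ D-⋆ˡ coeff s n ⟨
    (D coeff ⋆ s) n       ≡⟨ ⋆-congˡ s D-coeff n ⟩
    (shift^ 2 Q ⋆ s) n    ≡⟨ ⋆-shift^ˡ 2 Q s n ⟩
    shift^ 2 (Q ⋆ s) n    ≡⟨ D-D-squares n ⟨
    D (D s ⊖ δ₂) n        ∎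

  innerSum : Series
  innerSum = coeff ⋆ (s ∘ suc ∘ suc)

  s≗shift^2-s∘suc∘suc : s ≗ shift^ 2 (s ∘ suc ∘ suc)
  s≗shift^2-s∘suc∘suc 0 = refl
  s≗shift^2-s∘suc∘suc 1 = refl
  s≗shift^2-s∘suc∘suc (suc (suc n)) = refl

  s⊖t≗innerSum⋆t : s ⊖ t ≗ innerSum ⋆ t
  s⊖t≗innerSum⋆t = D-injective λ n → begin
    D (s ⊖ t) n                        ≡⟨ D-⊖ s t n ⟩
    D s n - D t n                      ≡⟨ cong (_-_ (D s n)) (D-t n) ⟩
    D s n - δ₂ n                       ≡⟨ coeff⋆s n ⟨
    (coeff ⋆ s) n                      ≡⟨ ⋆-congʳ coeff s≗shift^2-s∘suc∘suc n ⟩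
    (coeff ⋆ shift^ 2 (s ∘ suc ∘ suc)) n ≡⟨ ⋆-shift^ʳ 2 coeff (s ∘ suc ∘ suc) n ⟩
    shift^ 2 innerSum n                ≡⟨ shift^-cong 2 (⋆-identityʳ innerSum) n ⟨
    shift^ 2 (innerSum ⋆ 𝟙) n          ≡⟨ ⋆-shift^ʳ 2 innerSum 𝟙 n ⟨
    (innerSum ⋆ δ₂) n                  ≡⟨ ⋆-congʳ innerSum D-t n ⟨
    (innerSum ⋆ D t) n                 ≡⟨ D-⋆ʳ innerSum t n ⟩
    D (innerSum ⋆ t) n                 ∎

  s≡t+innerSum⋆t : ∀ n → s n ≡ t n + (innerSum ⋆ t) n
  s≡t+innerSum⋆t n = trans (x≡y+[x-y] (s n) (t n)) (cong (_+_ (t n)) (s⊖t≗innerSum⋆t n))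
    where
    x≡y+[x-y] : ∀ x y → x ≡ y + (x - y)
    x≡y+[x-y] = solve-∀

open import Defs
open import Data.Nat using (_+_; _*_)
import Data.Nat.Properties as ℕ
import Data.Integer as ℤ
import Data.Integer.Properties as ℤ
open import Data.Integer using (+_)
open import Data.List using (applyUpTo)
open import Data.Nat.ListAction using (sum)
import Data.List.Properties as List
open PowerSeries using (_⋆_; ∑; ∑-cong; ∑-*-distribʳ; ∑-dropLast; ⋆-as-∑-from-2)
open TribonacciSeries using (t; s; coeff; innerSum; s≡t+innerSum⋆t)
open ≡-Reasoning

T-cast : ∀ n → + T n ≡ t n
T-cast 0 = refl
T-cast 1 = refl
T-cast 2 = refl
T-cast (suc (suc (suc n))) = begin
  + (T n₂ + T n₁ + T n)            ≡⟨ ℤ.pos-+ (T n₂ + T n₁) (T n) ⟩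
  + (T n₂ + T n₁) ℤ.+ + T n        ≡⟨ cong (ℤ._+ + T n) (ℤ.pos-+ (T n₂) (T n₁)) ⟩
  + T n₂ ℤ.+ + T n₁ ℤ.+ + T n      ≡⟨ cong₂ ℤ._+_ (cong₂ ℤ._+_ (T-cast (suc (suc n))) (T-cast (suc n))) (T-cast n) ⟩
  t n₂ ℤ.+ t n₁ ℤ.+ t n            ∎
  where
  n₁ = suc n
  n₂ = suc n₁

T²-cast : ∀ n → + (T n * T n) ≡ s n
T²-cast n = trans (ℤ.pos-* (T n) (T n)) (cong₂ ℤ._*_ (T-cast n) (T-cast n))

coeffℕ : ℕ → ℕ
coeffℕ l = 4 * (T l + T (l ∸ 1)) ∸ 2 * δ l 2

coeff-cast : ∀ l → + coeffℕ l ≡ coeff l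
coeff-cast 0 = refl
coeff-cast 1 = refl
coeff-cast 2 = refl
coeff-cast (suc (suc (suc i))) = begin
  + (4 * (T (3 + i) + T (2 + i)))
    ≡⟨ ℤ.pos-* 4 (T (3 + i) + T (2 + i)) ⟩
  + 4 ℤ.* + (T (3 + i) + T (2 + i))
    ≡⟨ cong (ℤ._*_ (+ 4)) (ℤ.pos-+ (T (3 + i)) (T (2 + i))) ⟩
  + 4 ℤ.* (+ T (3 + i) ℤ.+ + T (2 + i))
    ≡⟨ cong (ℤ._*_ (+ 4)) (cong₂ ℤ._+_ (T-cast (3 + i)) (T-cast (2 + i))) ⟩
  + 4 ℤ.* (t (3 + i) ℤ.+ t (2 + i))
    ≡⟨ ℤ.+-identityʳ (+ 4 ℤ.* (t (3 + i) ℤ.+ t (2 + i))) ⟨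
  coeff (3 + i)
    ∎

sum-cast : ∀ m g → + sum (applyUpTo g m) ≡ ∑ m (+_ ∘ g)
sum-cast zero g = refl
sum-cast (suc m) g = trans (ℤ.pos-+ (g 0) _) (cong (ℤ._+_ (+ g 0)) (sum-cast m (g ∘ suc)))

Σ-cast : ∀ a b f → + Σ[ a ⋯ b ] f ≡ ∑ (suc b ∸ a) (λ i → + f (a + i))
Σ-cast a b f = trans (cong (+_ ∘ sum) (List.map-upTo (λ i → f (a + i)) (suc b ∸ a)))
                     (sum-cast (suc b ∸ a) (λ i → f (a + i)))

summand : ℕ → ℕ → ℕ → ℕ
summand k w l = coeffℕ l * (T (k ∸ l + 2) * T (k ∸ l + 2)) * T w

innerSum-cast : ∀ i w → + Σ[ 2 ⋯ 2 + i ] (summand (2 + i) w) ≡ innerSum (2 + i) ℤ.* t w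
innerSum-cast i w = begin
  + Σ[ 2 ⋯ 2 + i ] (summand (2 + i) w)
    ≡⟨ Σ-cast 2 (2 + i) (summand (2 + i) w) ⟩
  ∑ (suc i) (λ j → + summand (2 + i) w (2 + j))
    ≡⟨ ∑-cong (suc i) term-cast ⟩
  ∑ (suc i) (λ j → coeff (2 + j) ℤ.* s (2 + (i ∸ j)) ℤ.* t w)
    ≡⟨ ∑-*-distribʳ (suc i) (λ j → coeff (2 + j) ℤ.* s (2 + (i ∸ j))) (t w) ⟨
  ∑ (suc i) (λ j → coeff (2 + j) ℤ.* s (2 + (i ∸ j))) ℤ.* t w
    ≡⟨ cong (ℤ._* t w) (⋆-as-∑-from-2 coeff (s ∘ suc ∘ suc) refl refl i) ⟨
  innerSum (2 + i) ℤ.* t w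
    ∎
  where
  term-cast : ∀ j → + summand (2 + i) w (2 + j) ≡ coeff (2 + j) ℤ.* s (2 + (i ∸ j)) ℤ.* t w
  term-cast j = begin
    + (coeffℕ (2 + j) * (T (i ∸ j + 2) * T (i ∸ j + 2)) * T w)
      ≡⟨ ℤ.pos-* (coeffℕ (2 + j) * (T (i ∸ j + 2) * T (i ∸ j + 2))) (T w) ⟩
    + (coeffℕ (2 + j) * (T (i ∸ j + 2) * T (i ∸ j + 2))) ℤ.* + T w
      ≡⟨ cong (ℤ._* + T w) (ℤ.pos-* (coeffℕ (2 + j)) (T (i ∸ j + 2) * T (i ∸ j + 2))) ⟩
    + coeffℕ (2 + j) ℤ.* + (T (i ∸ j + 2) * T (i ∸ j + 2)) ℤ.* + T w
      ≡⟨ cong₂ ℤ._*_ (cong₂ ℤ._*_ (coeff-cast (2 + j)) (T²-cast (i ∸ j + 2))) (T-cast w) ⟩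
    coeff (2 + j) ℤ.* s (i ∸ j + 2) ℤ.* t w
      ≡⟨ cong (λ m → coeff (2 + j) ℤ.* s m ℤ.* t w) (ℕ.+-comm (i ∸ j) 2) ⟩
    coeff (2 + j) ℤ.* s (2 + (i ∸ j)) ℤ.* t w
      ∎

doubleSum : ℕ → ℕ
doubleSum n = Σ[ 2 ⋯ n ∸ 2 ] (λ k → Σ[ 2 ⋯ k ] (summand k (n ∸ k)))

doubleSum-cast : ∀ n → + doubleSum n ≡ (innerSum ⋆ t) n
doubleSum-cast 0 = refl
doubleSum-cast 1 = refl
doubleSum-cast 2 = refl
doubleSum-cast (suc (suc (suc p))) = begin
  + doubleSum (3 + p)
    ≡⟨ Σ-cast 2 (1 + p) (λ k → Σ[ 2 ⋯ k ] (summand k (3 + p ∸ k))) ⟩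
  ∑ p (λ i → + Σ[ 2 ⋯ 2 + i ] (summand (2 + i) (1 + p ∸ i)))
                            ≡⟨ ∑-cong p (λ i → innerSum-cast i (1 + p ∸ i)) ⟩
  ∑ p h                     ≡⟨ ∑-dropLast p h (h-vanishes p (cong t (ℕ.m+n∸n≡m 1 p))) ⟨
  ∑ (1 + p) h               ≡⟨ ∑-dropLast (1 + p) h (h-vanishes (1 + p) (cong t (ℕ.n∸n≡0 (1 + p)))) ⟨
  ∑ (2 + p) h               ≡⟨ ⋆-as-∑-from-2 innerSum t refl refl (1 + p) ⟨
  (innerSum ⋆ t) (3 + p)    ∎
  where
  h : ℕ → ℤ.ℤ
  h i = innerSum (2 + i) ℤ.* t (1 + p ∸ i)

  h-vanishes : ∀ i → t (1 + p ∸ i) ≡ ℤ.0ℤ → h i ≡ ℤ.0ℤ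
  h-vanishes i t≡0 = trans (cong (innerSum (2 + i) ℤ.*_) t≡0) (ℤ.*-zeroʳ (innerSum (2 + i)))

mainTheorem10 : (n : ℕ) →
    T n * T n ≡
      T n + Σ[ 2 ⋯ n ∸ 2 ] (λ k → Σ[ 2 ⋯ k ] (λ l →
        (4 * (T l + T (l ∸ 1)) ∸ 2 * δ l 2) * (T (k ∸ l + 2) * T (k ∸ l + 2)) * T (n ∸ k)))
mainTheorem10 n = ℤ.+-injective (begin
  + (T n * T n)                   ≡⟨ T²-cast n ⟩
  s n                             ≡⟨ s≡t+innerSum⋆t n ⟩
  t n ℤ.+ (innerSum ⋆ t) n        ≡⟨ cong₂ ℤ._+_ (T-cast n) (doubleSum-cast n) ⟨
  + T n ℤ.+ + doubleSum n         ≡⟨ ℤ.pos-+ (T n) (doubleSum n) ⟨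
  + (T n + doubleSum n)           ∎)
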